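{- Let $p\geq 11$ be a prime. For $1\leq a\leq p-1$ let $\gamma_a$ be the root in $\mathbb{Z}_p$ of $X^{p-1}+pB_{p-1}$ with $\gamma_a\equiv a\pmod p$, and define $z_a\in\mathbb{Z}_p$ by $\gamma_a=a+pz_a$. Then $$z_a\equiv a\big(q_a+(pB_{p-1})_1\big)+ap\big(1+(pB_{p-1})_1\big)\big(q_a+(pB_{p-1})_1\big)\pmod{p^2}.$$
   Context: $B_{p-1}$ is the Bernoulli number; $pB_{p-1}\equiv-1\pmod p$, so such roots exist uniquely by Hensel's lemma. $(pB_{p-1})_1:=\frac{1+pB_{p-1}}{p}$ is the Agoh–Giuga quotient and $q_a:=\frac{a^{p-1}-1}{p}$ the Fermat quotient. Congruences are in $\mathbb{Z}_p$. -}

module Defs where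

open import Data.Nat as ℕ using (ℕ; zero; suc)
open import Data.Nat.Divisibility as ℕD using ()
open import Data.Integer as ℤ using (ℤ; +_)
open import Data.Rational as ℚ using (ℚ; _+_; _*_; _-_; -_; _/_; 0ℚ; 1ℚ; ↧ₙ_)
open import Data.List using (List; []; _∷_; _∷ʳ_; length; lookup; foldr; zip; map; reverse)
open import Data.List as L using ()
open import Data.Nat.Combinatorics using (_C_)
open import Data.Product using (∃; _×_)
open import Relation.Binary.PropositionalEquality using (_≡_)
open import Relation.Nullary using (¬_)

ℕ→ℚ : ℕ → ℚ
ℕ→ℚ n = + n / 1

ℤ→ℚ : ℤ → ℚ
ℤ→ℚ z = z / 1

infixr 8 _^ℚ_
_^ℚ_ : ℚ → ℕ → ℚ
x ^ℚ zero  = 1ℚ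
x ^ℚ suc n = x * (x ^ℚ n)

-- Bernoulli numbers (convention B_1 = -1/2; irrelevant here since only
-- even index p-1 is used) via the recurrence
--   B_0 = 1,  B_n = -(1/(n+1)) * Σ_{k=0}^{n-1} C(n+1,k) B_k.
-- bernoulliList n = [B_0, ..., B_n]
private
  nextB : ℕ → List ℚ → ℚ
  nextB n bs = - ((+ 1 / suc n) * go 0 bs)
    where
    go : ℕ → List ℚ → ℚ
    go k []       = 0ℚ
    go k (b ∷ bs) = ℕ→ℚ (suc n C k) * b + go (suc k) bs

bernoulliList : ℕ → List ℚ
bernoulliList zero    = 1ℚ ∷ []
bernoulliList (suc n) = let bs = bernoulliList n in bs ∷ʳ nextB (suc n) bs

bernoulli : ℕ → ℚ
bernoulli n = lastOr 0ℚ (bernoulliList n)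
  where
  lastOr : ℚ → List ℚ → ℚ
  lastOr d []       = d
  lastOr d (x ∷ xs) = lastOr x xs

-- Congruence in ℤ_p (restricted to ℚ ∩ ℤ_p elements):
-- x ≡ y (mod p^k) iff x - y = p^k * r with r a rational whose
-- denominator is prime to p (i.e. r ∈ ℤ_(p) ⊂ ℤ_p).
infix 4 _≡_[mod_^_]
_≡_[mod_^_] : ℚ → ℚ → ℕ → ℕ → Set
x ≡ y [mod p ^ k ] = ∃ λ (r : ℚ) → (x - y ≡ (ℕ→ℚ p ^ℚ k) * r) × ¬ (p ℕD.∣ ↧ₙ r)

-- A p-adic integer represented by a coherent sequence of integer
-- approximations: γ n is γ mod p^n, with γ (n+1) ≡ γ n (mod p^n).
IsCoherent : ℕ → (ℕ → ℤ) → Set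
IsCoherent p γ = ∀ n → ℤ→ℚ (γ (suc n)) ≡ ℤ→ℚ (γ n) [mod p ^ n ]

{-# OPTIONS --safe #-}
-- Write γ₃ = a + p z with z ∈ ℤ₍ₚ₎. By Fermat a^(p-1) = 1 + p q_a, and C(p-1, 2) ≡ 1 (mod p)
-- since p is odd, so expanding γ₃^(p-1) binomially modulo p³ and using γ₃^(p-1) + pB ≡ 0 (mod p³)
-- gives (pB)₁ = a^(p-2) z − q_a − p (a^(p-2) z + a^(p-3) z²) + p² K with K ∈ ℤ₍ₚ₎.
-- Substituting this into the right-hand side, the difference with z is p² times an explicit
-- element of ℤ₍ₚ₎ plus a multiple of a^(p-1) − (1 + p q_a) = 0.
module Submission where

open import Defs
open import Data.Nat using (ℕ; _≤_; _∸_; suc; zero; s≤s; z≤n)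
open import Data.Nat.Primality using (Prime; euclidsLemma; ¬prime[1])
open import Data.Nat.Divisibility using (_∣_; divides; ∣⇒≤; _∣0; ∣-trans; ∣1⇒≡1)
open import Data.Nat.Combinatorics using (_C_; nC1≡n; nCn≡1; k>n⇒nCk≡0; nCk+nC[k+1]≡[n+1]C[k+1])
open import Data.Integer using (ℤ; +_)
open import Data.Product using (∃; _,_; proj₂)
open import Data.Sum using (inj₁; inj₂)
open import Data.Empty using (⊥-elim)
open import Function using (_∘_)
open import Relation.Binary.PropositionalEquality
open import Relation.Nullary using (¬_)

module NatCongruences where
  open import Data.Nat using (_+_; _*_; _^_; _<_)
  open import Data.Nat.Properties
    using (*-zeroʳ; *-identityˡ; *-identityʳ; *-comm; *-suc; +-identityʳ; +-comm; +-cancelˡ-≡; m+n≡0⇒m≡0; <⇒≱; n<1+n; <-trans)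
  open import Data.Nat.Tactic.RingSolver using (solve-∀; solve)
  open import Data.List using (_∷_; [])
  open ≡-Reasoning

  [k+1]*[n+1]C[k+1]≡[n+1]*nCk : ∀ n k → suc k * (suc n C suc k) ≡ suc n * (n C k)
  [k+1]*[n+1]C[k+1]≡[n+1]*nCk zero    zero    = refl
  [k+1]*[n+1]C[k+1]≡[n+1]*nCk zero    (suc k) = *-zeroʳ (2 + k)
  [k+1]*[n+1]C[k+1]≡[n+1]*nCk (suc n) zero    =
    trans (*-identityˡ _) (trans (nC1≡n (2 + n)) (sym (*-identityʳ (2 + n))))
  [k+1]*[n+1]C[k+1]≡[n+1]*nCk (suc n) (suc k) = begin
    (2 + k) * ((2 + n) C (2 + k))                   ≡⟨ cong ((2 + k) *_) (nCk+nC[k+1]≡[n+1]C[k+1] (1 + n) (1 + k)) ⟨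
    (2 + k) * (X + Y)                               ≡⟨ split k X Y ⟩
    (1 + k) * X + X + (2 + k) * Y                   ≡⟨ cong₂ (λ u v → u + X + v) ([k+1]*[n+1]C[k+1]≡[n+1]*nCk n k)
                                                                                 ([k+1]*[n+1]C[k+1]≡[n+1]*nCk n (suc k)) ⟩
    (1 + n) * (n C k) + X + (1 + n) * (n C (1 + k)) ≡⟨ regroup n (n C k) (n C (1 + k)) X ⟩
    (1 + n) * (n C k + n C (1 + k)) + X             ≡⟨ cong (λ t → (1 + n) * t + X) (nCk+nC[k+1]≡[n+1]C[k+1] n k) ⟩
    (1 + n) * X + X                                 ≡⟨ merge n X ⟩
    (2 + n) * X                                     ∎
    where
    X Y : ℕ
    X = (1 + n) C (1 + k)
    Y = (1 + n) C (2 + k)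
    split : ∀ k X Y → (2 + k) * (X + Y) ≡ (1 + k) * X + X + (2 + k) * Y
    split = solve-∀
    regroup : ∀ n a b X → (1 + n) * a + X + (1 + n) * b ≡ (1 + n) * (a + b) + X
    regroup = solve-∀
    merge : ∀ n X → (1 + n) * X + X ≡ (2 + n) * X
    merge = solve-∀

  p∣pC[k+1] : ∀ {p k} → Prime p → suc k < p → p ∣ p C suc k
  p∣pC[k+1] {suc n} {k} p-prime k<p
    with euclidsLemma (suc k) (suc n C suc k) p-prime
           (divides (n C k) (trans ([k+1]*[n+1]C[k+1]≡[n+1]*nCk n k) (*-comm (suc n) (n C k))))
  ... | inj₁ p∣k+1 = ⊥-elim (<⇒≱ k<p (∣⇒≤ p∣k+1))
  ... | inj₂ p∣pCk = p∣pCk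

  binomialSum : (n x k : ℕ) → ℕ
  binomialSum n x zero    = 0
  binomialSum n x (suc k) = binomialSum n x k + (n C k) * x ^ k

  binomialSum-suc : ∀ n x k →
    binomialSum (suc n) x (suc k) ≡ binomialSum n x (suc k) + x * binomialSum n x k
  binomialSum-suc n x zero    = cong suc (sym (*-zeroʳ x))
  binomialSum-suc n x (suc k) = begin
    binomialSum (suc n) x (suc k) + (suc n C suc k) * x ^ suc k
      ≡⟨ cong₂ (λ s c → s + c * x ^ suc k) (binomialSum-suc n x k) (sym (nCk+nC[k+1]≡[n+1]C[k+1] n k)) ⟩
    (S₁ + x * S₀) + (n C k + n C suc k) * (x * x ^ k)
      ≡⟨ regroup S₁ S₀ x (x ^ k) (n C k) (n C suc k) ⟩
    (S₁ + (n C suc k) * x ^ suc k) + x * (S₀ + (n C k) * x ^ k) ∎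
    where
    S₀ S₁ : ℕ
    S₀ = binomialSum n x k
    S₁ = binomialSum n x (suc k)
    regroup : ∀ S₁ S₀ x y c₀ c₁ → (S₁ + x * S₀) + (c₀ + c₁) * (x * y) ≡ (S₁ + c₁ * (x * y)) + x * (S₀ + c₀ * y)
    regroup = solve-∀

  binomial-theorem : ∀ n x → (x + 1) ^ n ≡ binomialSum n x (suc n)
  binomial-theorem zero    x = refl
  binomial-theorem (suc n) x = begin
    (x + 1) * (x + 1) ^ n              ≡⟨ cong ((x + 1) *_) (binomial-theorem n x) ⟩
    (x + 1) * S                        ≡⟨ distrib x S ⟩
    S + x * S                          ≡⟨ cong (_+ x * S) (+-identityʳ S) ⟨
    S + 0 * x ^ suc n + x * S          ≡⟨ cong (λ c → S + c * x ^ suc n + x * S) (k>n⇒nCk≡0 (n<1+n n)) ⟨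
    binomialSum n x (2 + n) + x * S    ≡⟨ binomialSum-suc n x (suc n) ⟨
    binomialSum (suc n) x (2 + n)      ∎
    where
    S : ℕ
    S = binomialSum n x (suc n)
    distrib : ∀ x S → (x + 1) * S ≡ S + x * S
    distrib = solve-∀

  binomialSum≡1+pm : ∀ {p} x k → Prime p → k < p → ∃ λ m → binomialSum p x (suc k) ≡ 1 + p * m
  binomialSum≡1+pm {p} x zero    _       _   = 0 , cong suc (sym (*-zeroʳ p))
  binomialSum≡1+pm {p} x (suc k) p-prime k<p
    with binomialSum≡1+pm x k p-prime (<-trans (n<1+n k) k<p) | p∣pC[k+1] p-prime k<p
  ... | m , eq | divides c pCk≡cp = m + c * x ^ suc k , (begin
    binomialSum p x (suc k) + (p C suc k) * x ^ suc k ≡⟨ cong₂ (λ s c → s + c * x ^ suc k) eq pCk≡cp ⟩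
    1 + p * m + c * p * x ^ suc k                     ≡⟨ factor p m c (x ^ suc k) ⟩
    1 + p * (m + c * x ^ suc k)                       ∎)
    where
    factor : ∀ p m c y → 1 + p * m + c * p * y ≡ 1 + p * (m + c * y)
    factor = solve-∀

  [x+1]ᵖ≡xᵖ+1+pm : ∀ {p} → Prime p → ∀ x → ∃ λ m → (x + 1) ^ p ≡ x ^ p + 1 + p * m
  [x+1]ᵖ≡xᵖ+1+pm {suc n} p-prime x with binomialSum≡1+pm x n p-prime (n<1+n n)
  ... | m , eq = m , (begin
    (x + 1) ^ p                           ≡⟨ binomial-theorem p x ⟩
    binomialSum p x p + (p C p) * x ^ p   ≡⟨ cong₂ (λ s c → s + c * x ^ p) eq (nCn≡1 p) ⟩
    1 + p * m + 1 * x ^ p                 ≡⟨ swap p m (x ^ p) ⟩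
    x ^ p + 1 + p * m                     ∎)
    where
    p : ℕ
    p = suc n
    swap : ∀ p m y → 1 + p * m + 1 * y ≡ y + 1 + p * m
    swap = solve-∀

  aᵖ≡a+pk : ∀ {p} → Prime p → ∀ a → ∃ λ k → a ^ p ≡ a + p * k
  aᵖ≡a+pk {suc n} p-prime zero    = 0 , sym (*-zeroʳ (suc n))
  aᵖ≡a+pk {p}     p-prime (suc a) with aᵖ≡a+pk p-prime a | [x+1]ᵖ≡xᵖ+1+pm p-prime a
  ... | k , aᵖ≡a+pk | m , [a+1]ᵖ≡aᵖ+1+pm = k + m , (begin
    suc a ^ p               ≡⟨ cong (_^ p) (+-comm 1 a) ⟩
    (a + 1) ^ p             ≡⟨ [a+1]ᵖ≡aᵖ+1+pm ⟩
    a ^ p + 1 + p * m       ≡⟨ cong (λ t → t + 1 + p * m) aᵖ≡a+pk ⟩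
    a + p * k + 1 + p * m   ≡⟨ collect a p k m ⟩
    suc a + p * (k + m)     ∎)
    where
    collect : ∀ a p k m → a + p * k + 1 + p * m ≡ suc a + p * (k + m)
    collect = solve-∀

  p∤d∧dc≡d+pm⇒c≡1+pe : ∀ {p d c m} → Prime p → ¬ p ∣ d → d * c ≡ d + p * m → ∃ λ e → c ≡ 1 + p * e
  p∤d∧dc≡d+pm⇒c≡1+pe {p} {d} {zero} _ p∤d eq =
    ⊥-elim (p∤d (subst (p ∣_) (sym (m+n≡0⇒m≡0 d (trans (sym eq) (*-zeroʳ d)))) (p ∣0)))
  p∤d∧dc≡d+pm⇒c≡1+pe {p} {d} {suc c} {m} p-prime p∤d eq
    with euclidsLemma d c p-prime (divides m (trans dc≡pm (*-comm p m)))
    where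
    dc≡pm : d * c ≡ p * m
    dc≡pm = +-cancelˡ-≡ d _ _ (trans (sym (*-suc d c)) eq)
  ... | inj₁ p∣d = ⊥-elim (p∤d p∣d)
  ... | inj₂ (divides e c≡ep) = e , cong suc (trans c≡ep (*-comm e p))

  a^[p-1]≡1+pk : ∀ {p a} → Prime p → 0 < a → a < p → ∃ λ k → a ^ (p ∸ 1) ≡ 1 + p * k
  a^[p-1]≡1+pk {suc n} {a@(suc _)} p-prime _ a<p =
    p∤d∧dc≡d+pm⇒c≡1+pe p-prime (λ p∣a → <⇒≱ a<p (∣⇒≤ p∣a)) (proj₂ (aᵖ≡a+pk p-prime a))

  [p-1]C2≡1+pe : ∀ {p} → Prime p → 2 < p → ∃ λ e → (p ∸ 1) C 2 ≡ 1 + p * e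
  [p-1]C2≡1+pe {2} _ (s≤s (s≤s ()))
  [p-1]C2≡1+pe {suc (suc (suc m))} p-prime _ =
    p∤d∧dc≡d+pm⇒c≡1+pe {m = m} p-prime (λ p∣2 → <⇒≱ (s≤s (s≤s (s≤s z≤n))) (∣⇒≤ p∣2)) (begin
      2 * ((2 + m) C 2)          ≡⟨ [k+1]*[n+1]C[k+1]≡[n+1]*nCk (1 + m) 1 ⟩
      (2 + m) * ((1 + m) C 1)    ≡⟨ cong ((2 + m) *_) (nC1≡n (1 + m)) ⟩
      (2 + m) * (1 + m)          ≡⟨ solve (m ∷ []) ⟩
      2 + (3 + m) * m            ∎)

open NatCongruences using (a^[p-1]≡1+pk; [p-1]C2≡1+pe)

import Data.Nat as ℕ
import Data.Nat.Properties as ℕₚ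
import Data.Integer as ℤ
import Data.Integer.Properties as ℤₚ
open import Data.Nat.Coprimality using (1-coprimeTo) renaming (sym to coprime-sym)
open import Data.Rational using (ℚ; _+_; _*_; _-_; _/_; 0ℚ; 1ℚ; -_; mkℚ; ↧ₙ_)
open import Data.Rational.Properties
  using (normalize-coprime; /-cong; *-inverseʳ; ↧-+; ↧-*; ↧-neg; *-identityˡ; *-identityʳ; *-assoc; *-distribˡ-+; +-inverseʳ)
open import Data.Rational.Solver using (module +-*-Solver)
open +-*-Solver
open ≡-Reasoning

ℕ→ℚ≡mkℚ : ∀ n → ℕ→ℚ n ≡ mkℚ (+ n) 0 (coprime-sym (1-coprimeTo n))
ℕ→ℚ≡mkℚ n = normalize-coprime _

ℕ→ℚ-homo-+ : ∀ m n → ℕ→ℚ (m ℕ.+ n) ≡ ℕ→ℚ m + ℕ→ℚ n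
ℕ→ℚ-homo-+ m n = trans
  (/-cong {+ (m ℕ.+ n)} {1} (sym (cong₂ ℤ._+_ (ℤₚ.*-identityʳ (+ m)) (ℤₚ.*-identityʳ (+ n)))) refl)
  (sym (cong₂ _+_ (ℕ→ℚ≡mkℚ m) (ℕ→ℚ≡mkℚ n)))

ℕ→ℚ-homo-* : ∀ m n → ℕ→ℚ (m ℕ.* n) ≡ ℕ→ℚ m * ℕ→ℚ n
ℕ→ℚ-homo-* m n = trans
  (/-cong {+ (m ℕ.* n)} {1} (ℤₚ.pos-* m n) refl)
  (sym (cong₂ _*_ (ℕ→ℚ≡mkℚ m) (ℕ→ℚ≡mkℚ n)))

ℕ→ℚ-homo-^ : ∀ m n → ℕ→ℚ (m ℕ.^ n) ≡ ℕ→ℚ m ^ℚ n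
ℕ→ℚ-homo-^ m zero    = refl
ℕ→ℚ-homo-^ m (suc n) = trans (ℕ→ℚ-homo-* m (m ℕ.^ n)) (cong (ℕ→ℚ m *_) (ℕ→ℚ-homo-^ m n))

ℕ→ℚ-1+m*n : ∀ {x} m n → x ≡ 1 ℕ.+ m ℕ.* n → ℕ→ℚ x ≡ 1ℚ + ℕ→ℚ m * ℕ→ℚ n
ℕ→ℚ-1+m*n m n refl = trans (ℕ→ℚ-homo-+ 1 (m ℕ.* n)) (cong (λ t → 1ℚ + t) (ℕ→ℚ-homo-* m n))

ℕ→ℚ≡ℕ→ℚ[1+n]-1 : ∀ n → ℕ→ℚ n ≡ ℕ→ℚ (suc n) - 1ℚ
ℕ→ℚ≡ℕ→ℚ[1+n]-1 n = trans (solve 1 (λ x → x := (con 1ℚ :+ x) :- con 1ℚ) refl (ℕ→ℚ n))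
                          (cong (_- 1ℚ) (sym (ℕ→ℚ-homo-+ 1 n)))

ℕ→ℚ-*-inverseʳ : ∀ n → ℕ→ℚ (suc n) * (+ 1 / suc n) ≡ 1ℚ
ℕ→ℚ-*-inverseʳ n
  rewrite ℕ→ℚ≡mkℚ (suc n) | normalize-coprime {1} {n} (1-coprimeTo (suc n))
  = *-inverseʳ (mkℚ (+ suc n) 0 (coprime-sym (1-coprimeTo (suc n))))

^ℚ-homo-+ : ∀ x m n → x ^ℚ (m ℕ.+ n) ≡ x ^ℚ m * x ^ℚ n
^ℚ-homo-+ x zero    n = sym (*-identityˡ (x ^ℚ n))
^ℚ-homo-+ x (suc m) n = trans (cong (x *_) (^ℚ-homo-+ x m n)) (sym (*-assoc x (x ^ℚ m) (x ^ℚ n)))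

*-cancelʳ-inverse : ∀ {P P⁻¹} x → P * P⁻¹ ≡ 1ℚ → (P * x) * P⁻¹ ≡ x
*-cancelʳ-inverse {P} {P⁻¹} x PP⁻¹≡1 = begin
  (P * x) * P⁻¹  ≡⟨ solve 3 (λ P P⁻¹ x → (P :* x) :* P⁻¹ := x :* (P :* P⁻¹)) refl P P⁻¹ x ⟩
  x * (P * P⁻¹)  ≡⟨ cong (x *_) PP⁻¹≡1 ⟩
  x * 1ℚ         ≡⟨ *-identityʳ x ⟩
  x              ∎

binomialRemainder : ℕ → ℚ → ℚ → ℚ
binomialRemainder zero    A X = 0ℚ
binomialRemainder (suc m) A X = A * T + ℕ→ℚ ((2 ℕ.+ m) C 2) * A ^ℚ m + X * T
  where
  T : ℚ
  T = binomialRemainder m A X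

binomial-mod-X³ : ∀ m A X →
  (A + X) ^ℚ (2 ℕ.+ m) ≡ A ^ℚ (2 ℕ.+ m) + ℕ→ℚ (2 ℕ.+ m) * A ^ℚ (1 ℕ.+ m) * X
                           + ℕ→ℚ ((2 ℕ.+ m) C 2) * A ^ℚ m * X * X + X * X * X * binomialRemainder m A X
binomial-mod-X³ zero A X =
  solve 2 (λ A X → (A :+ X) :* ((A :+ X) :* con 1ℚ)
                   := A :* (A :* con 1ℚ) :+ con (ℕ→ℚ 2) :* (A :* con 1ℚ) :* X
                      :+ con 1ℚ :* con 1ℚ :* X :* X :+ X :* X :* X :* con 0ℚ) refl A X
binomial-mod-X³ (suc m) A X = begin
  (A + X) * (A + X) ^ℚ (2 ℕ.+ m)
    ≡⟨ cong ((A + X) *_) (binomial-mod-X³ m A X) ⟩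
  (A + X) * (A * (A * Aᵐ) + n * (A * Aᵐ) * X + c * Aᵐ * X * X + X * X * X * T)
    ≡⟨ multiply A X T Aᵐ n c ⟩
  A * (A * (A * Aᵐ)) + (1ℚ + n) * (A * (A * Aᵐ)) * X + (n + c) * (A * Aᵐ) * X * X + X * X * X * (A * T + c * Aᵐ + X * T)
    ≡⟨ cong₂ (λ n′ c′ → A * (A * (A * Aᵐ)) + n′ * (A * (A * Aᵐ)) * X + c′ * (A * Aᵐ) * X * X + X * X * X * (A * T + c * Aᵐ + X * T))
             (sym (ℕ→ℚ-homo-+ 1 (2 ℕ.+ m))) pascal ⟩
  A * (A * (A * Aᵐ)) + ℕ→ℚ (3 ℕ.+ m) * (A * (A * Aᵐ)) * X + ℕ→ℚ ((3 ℕ.+ m) C 2) * (A * Aᵐ) * X * X + X * X * X * (A * T + c * Aᵐ + X * T)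
    ∎
  where
  Aᵐ n c T : ℚ
  Aᵐ = A ^ℚ m
  n  = ℕ→ℚ (2 ℕ.+ m)
  c  = ℕ→ℚ ((2 ℕ.+ m) C 2)
  T  = binomialRemainder m A X
  pascal : n + c ≡ ℕ→ℚ ((3 ℕ.+ m) C 2)
  pascal = begin
    n + c                                         ≡⟨ cong (λ k → ℕ→ℚ k + c) (nC1≡n (2 ℕ.+ m)) ⟨
    ℕ→ℚ ((2 ℕ.+ m) C 1) + c                       ≡⟨ ℕ→ℚ-homo-+ ((2 ℕ.+ m) C 1) ((2 ℕ.+ m) C 2) ⟨
    ℕ→ℚ ((2 ℕ.+ m) C 1 ℕ.+ (2 ℕ.+ m) C 2)         ≡⟨ cong ℕ→ℚ (nCk+nC[k+1]≡[n+1]C[k+1] (2 ℕ.+ m) 1) ⟩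
    ℕ→ℚ ((3 ℕ.+ m) C 2)                           ∎
  multiply : ∀ A X T Aᵐ n c →
    (A + X) * (A * (A * Aᵐ) + n * (A * Aᵐ) * X + c * Aᵐ * X * X + X * X * X * T)
    ≡ A * (A * (A * Aᵐ)) + (1ℚ + n) * (A * (A * Aᵐ)) * X + (n + c) * (A * Aᵐ) * X * X
      + X * X * X * (A * T + c * Aᵐ + X * T)
  multiply = solve 6 (λ A X T Aᵐ n c →
    (A :+ X) :* (A :* (A :* Aᵐ) :+ n :* (A :* Aᵐ) :* X :+ c :* Aᵐ :* X :* X :+ X :* X :* X :* T)
    := A :* (A :* (A :* Aᵐ)) :+ (con 1ℚ :+ n) :* (A :* (A :* Aᵐ)) :* X :+ (n :+ c) :* (A :* Aᵐ) :* X :* X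
       :+ X :* X :* X :* (A :* T :+ c :* Aᵐ :+ X :* T)) refl

γᴺ-expansion : (P A b e z T aᴺ : ℚ) → ℚ
γᴺ-expansion P A b e z T aᴺ =
  aᴺ + (P - 1ℚ) * (A * b) * (P * z) + (1ℚ + P * e) * b * (P * z) * (P * z) + P * z * (P * z) * (P * z) * T

γᴺ≡γᴺ-expansion : ∀ m P A g z e → g - A ≡ P ^ℚ 1 * z →
  ℕ→ℚ (2 ℕ.+ m) ≡ P - 1ℚ → ℕ→ℚ ((2 ℕ.+ m) C 2) ≡ 1ℚ + P * e →
  g ^ℚ (2 ℕ.+ m) ≡ γᴺ-expansion P A (A ^ℚ m) e z (binomialRemainder m A (P * z)) (A * (A * A ^ℚ m))
γᴺ≡γᴺ-expansion m P A g z e g-A≡Pz N≡P-1 C≡1+Pe = begin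
  g ^ℚ (2 ℕ.+ m)          ≡⟨ cong (_^ℚ (2 ℕ.+ m)) g≡A+Pz ⟩
  (A + P * z) ^ℚ (2 ℕ.+ m) ≡⟨ binomial-mod-X³ m A (P * z) ⟩
  A * (A * b) + ℕ→ℚ (2 ℕ.+ m) * (A * b) * (P * z) + ℕ→ℚ ((2 ℕ.+ m) C 2) * b * (P * z) * (P * z) + P * z * (P * z) * (P * z) * T
    ≡⟨ cong₂ (λ n c → A * (A * b) + n * (A * b) * (P * z) + c * b * (P * z) * (P * z) + P * z * (P * z) * (P * z) * T)
             N≡P-1 C≡1+Pe ⟩
  γᴺ-expansion P A b e z T (A * (A * b)) ∎
  where
  b T : ℚ
  b = A ^ℚ m
  T = binomialRemainder m A (P * z)
  g≡A+Pz : g ≡ A + P * z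
  g≡A+Pz = trans (solve 2 (λ g A → g := A :+ (g :- A)) refl g A)
                 (cong (λ t → A + t) (trans g-A≡Pz (cong (_* z) (*-identityʳ P))))

-- P = p and b = a^(p-3), so that A * (A * b) = a^(p-1); moreover γ₃ = A + P z, a^(p-1) = 1 + P q,
-- C(p-1, 2) = 1 + P e, T is the binomial remainder of γ₃^(p-1) and γ₃^(p-1) + pB = P³ r.
module AgohGiugaQuotient (P A b q e z T r : ℚ) where

  K : ℚ
  K = r - e * b * z * z - z * z * z * T

  agohGiuga : ℚ
  agohGiuga = A * b * z - q + P * (P * K - (A * b * z + b * z * z))

  residue : ℚ
  residue = - (q * z * (A * b * z - q) + A * K + A * g₁ * (1ℚ + (1ℚ + 1ℚ) * (A * b * z) - q) + P * A * g₁ * g₁)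
    where
    g₁ : ℚ
    g₁ = P * K - (A * b * z + b * z * z)

  -- The last factor is a^(p-1) − (1 + p q), which vanishes by Fermat; keeping it makes this
  -- a polynomial identity.
  residue-identity :
    z - (A * (q + agohGiuga) + A * P * (1ℚ + agohGiuga) * (q + agohGiuga))
    ≡ P ^ℚ 2 * residue - z * (1ℚ + P * (A * b * z - q)) * (A * (A * b) - (1ℚ + P * q))
  residue-identity = solve 8 (λ P A b q e z T r →
    let K  = r :- e :* b :* z :* z :- z :* z :* z :* T
        g₁ = P :* K :- (A :* b :* z :+ b :* z :* z)
        g  = A :* b :* z :- q :+ P :* g₁
        s  = :- (q :* z :* (A :* b :* z :- q) :+ A :* K
                 :+ A :* g₁ :* (con 1ℚ :+ (con 1ℚ :+ con 1ℚ) :* (A :* b :* z) :- q) :+ P :* A :* g₁ :* g₁)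
    in z :- (A :* (q :+ g) :+ A :* P :* (con 1ℚ :+ g) :* (q :+ g))
       := P :* (P :* con 1ℚ) :* s :- z :* (con 1ℚ :+ P :* (A :* b :* z :- q)) :* (A :* (A :* b) :- (con 1ℚ :+ P :* q)))
    refl P A b q e z T r

  expansion : ℚ → ℚ
  expansion = γᴺ-expansion P A b e z T

  agohGiuga-expansion : ∀ {B} → A * (A * b) ≡ 1ℚ + P * q →
    expansion (A * (A * b)) + B - 0ℚ ≡ P ^ℚ 3 * r → 1ℚ + B ≡ P * agohGiuga
  agohGiuga-expansion {B} aᴺ≡1+Pq root = begin
    1ℚ + B                                   ≡⟨ cong (λ t → 1ℚ + t) B≡P³r-G ⟩
    1ℚ + (P ^ℚ 3 * r - expansion (A * (A * b))) ≡⟨ cong (λ t → 1ℚ + (P ^ℚ 3 * r - expansion t)) aᴺ≡1+Pq ⟩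
    1ℚ + (P ^ℚ 3 * r - expansion (1ℚ + P * q)) ≡⟨ collect ⟩
    P * agohGiuga                            ∎
    where
    G : ℚ
    G = expansion (A * (A * b))
    B≡P³r-G : B ≡ P ^ℚ 3 * r - G
    B≡P³r-G = trans (solve 2 (λ G B → B := (G :+ B :- con 0ℚ) :- G) refl G B) (cong (_- G) root)
    collect : 1ℚ + (P ^ℚ 3 * r - expansion (1ℚ + P * q)) ≡ P * agohGiuga
    collect = solve 8 (λ P A b q e z T r →
      let K = r :- e :* b :* z :* z :- z :* z :* z :* T
      in con 1ℚ :+ (P :* (P :* (P :* con 1ℚ)) :* r
                    :- (con 1ℚ :+ P :* q :+ (P :- con 1ℚ) :* (A :* b) :* (P :* z)
                        :+ (con 1ℚ :+ P :* e) :* b :* (P :* z) :* (P :* z) :+ P :* z :* (P :* z) :* (P :* z) :* T))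
         := P :* (A :* b :* z :- q :+ P :* (P :* K :- (A :* b :* z :+ b :* z :* z)))) refl P A b q e z T r

  quotient-identity : ∀ {P⁻¹ g B} → P * P⁻¹ ≡ 1ℚ → A * (A * b) ≡ 1ℚ + P * q → g - A ≡ P ^ℚ 1 * z →
    expansion (A * (A * b)) + B - 0ℚ ≡ P ^ℚ 3 * r →
    let AG = (1ℚ + B) * P⁻¹
        qa = (A * (A * b) - 1ℚ) * P⁻¹
        za = (g - A) * P⁻¹
    in za - (A * (qa + AG) + A * P * (1ℚ + AG) * (qa + AG)) ≡ P ^ℚ 2 * residue
  quotient-identity {P⁻¹} {g} {B} PP⁻¹≡1 aᴺ≡1+Pq g-A≡Pz root = begin
    discrepancy za qa AG         ≡⟨ cong₂ (λ x y → discrepancy x y AG) za≡z qa≡q ⟩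
    discrepancy z q AG           ≡⟨ cong (discrepancy z q) AG≡agohGiuga ⟩
    discrepancy z q agohGiuga    ≡⟨ residue-identity ⟩
    P ^ℚ 2 * residue - λ′ * (A * (A * b) - (1ℚ + P * q))
      ≡⟨ cong (λ t → P ^ℚ 2 * residue - λ′ * t) (trans (cong (_- (1ℚ + P * q)) aᴺ≡1+Pq) (+-inverseʳ (1ℚ + P * q))) ⟩
    P ^ℚ 2 * residue - λ′ * 0ℚ   ≡⟨ solve 2 (λ x y → x :- y :* con 0ℚ := x) refl (P ^ℚ 2 * residue) λ′ ⟩
    P ^ℚ 2 * residue             ∎
    where
    λ′ AG qa za : ℚ
    λ′ = z * (1ℚ + P * (A * b * z - q))
    AG = (1ℚ + B) * P⁻¹
    qa = (A * (A * b) - 1ℚ) * P⁻¹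
    za = (g - A) * P⁻¹
    cancel : ∀ x → (P * x) * P⁻¹ ≡ x
    cancel x = *-cancelʳ-inverse {P} {P⁻¹} x PP⁻¹≡1
    discrepancy : ℚ → ℚ → ℚ → ℚ
    discrepancy x y h = x - (A * (y + h) + A * P * (1ℚ + h) * (y + h))
    za≡z : za ≡ z
    za≡z = trans (cong (_* P⁻¹) (trans g-A≡Pz (cong (_* z) (*-identityʳ P)))) (cancel z)
    qa≡q : qa ≡ q
    qa≡q = begin
      (A * (A * b) - 1ℚ) * P⁻¹   ≡⟨ cong (λ t → (t - 1ℚ) * P⁻¹) aᴺ≡1+Pq ⟩
      (1ℚ + P * q - 1ℚ) * P⁻¹    ≡⟨ cong (_* P⁻¹) (solve 2 (λ P q → con 1ℚ :+ P :* q :- con 1ℚ := P :* q) refl P q) ⟩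
      (P * q) * P⁻¹              ≡⟨ cancel q ⟩
      q                          ∎
    AG≡agohGiuga : AG ≡ agohGiuga
    AG≡agohGiuga = trans (cong (_* P⁻¹) (agohGiuga-expansion aᴺ≡1+Pq root)) (cancel agohGiuga)

record Integral (p : ℕ) (x : ℚ) : Set where
  constructor integral
  field p∤↧ₙ : ¬ p ∣ ↧ₙ x
open Integral

d*k≡a*b⇒d∣a*b : ∀ {d a b} (k : ℤ) → + d ℤ.* k ≡ + a ℤ.* + b → d ∣ a ℕ.* b
d*k≡a*b⇒d∣a*b {d} {a} {b} k eq = divides ℤ.∣ k ∣ (begin
  a ℕ.* b             ≡⟨ ℤₚ.abs-* (+ a) (+ b) ⟨
  ℤ.∣ + a ℤ.* + b ∣   ≡⟨ cong ℤ.∣_∣ eq ⟨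
  ℤ.∣ + d ℤ.* k ∣     ≡⟨ ℤₚ.abs-* (+ d) k ⟩
  d ℕ.* ℤ.∣ k ∣       ≡⟨ ℕₚ.*-comm d ℤ.∣ k ∣ ⟩
  ℤ.∣ k ∣ ℕ.* d       ∎)

module Integrality {p : ℕ} (p-prime : Prime p) where

  ℕ→ℚ-integral : ∀ n → Integral p (ℕ→ℚ n)
  ℕ→ℚ-integral n rewrite ℕ→ℚ≡mkℚ n =
    integral (λ p∣1 → ¬prime[1] (subst Prime (∣1⇒≡1 p∣1) p-prime))

  private
    p∤a∧p∤b∧c∣ab⇒p∤c : ∀ {a b c} → ¬ p ∣ a → ¬ p ∣ b → c ∣ a ℕ.* b → ¬ p ∣ c
    p∤a∧p∤b∧c∣ab⇒p∤c p∤a p∤b c∣ab p∣c with euclidsLemma _ _ p-prime (∣-trans p∣c c∣ab)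
    ... | inj₁ p∣a = p∤a p∣a
    ... | inj₂ p∣b = p∤b p∣b

  +-integral : ∀ {x y} → Integral p x → Integral p y → Integral p (x + y)
  +-integral {x@record{}} {y@record{}} (integral p∤x) (integral p∤y) =
    integral (p∤a∧p∤b∧c∣ab⇒p∤c p∤x p∤y (d*k≡a*b⇒d∣a*b {a = ↧ₙ x} {↧ₙ y} _ (↧-+ x y)))

  *-integral : ∀ {x y} → Integral p x → Integral p y → Integral p (x * y)
  *-integral {x@record{}} {y@record{}} (integral p∤x) (integral p∤y) =
    integral (p∤a∧p∤b∧c∣ab⇒p∤c p∤x p∤y (d*k≡a*b⇒d∣a*b {a = ↧ₙ x} {↧ₙ y} _ (↧-* x y)))

  -‿integral : ∀ {x} → Integral p x → Integral p (- x)
  -‿integral {x} (integral p∤x) = integral (p∤x ∘ subst (p ∣_) (cong ℤ.∣_∣ (↧-neg x)))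

  ^-integral : ∀ {x} n → Integral p x → Integral p (x ^ℚ n)
  ^-integral zero    _      = ℕ→ℚ-integral 1
  ^-integral (suc n) x∈ℤ₍ₚ₎ = *-integral x∈ℤ₍ₚ₎ (^-integral n x∈ℤ₍ₚ₎)

  ≡-mod-trans : ∀ {x y z k} → x ≡ y [mod p ^ k ] → y ≡ z [mod p ^ k ] → x ≡ z [mod p ^ k ]
  ≡-mod-trans {x} {y} {z} {k} (r , x-y≡pᵏr , p∤r) (s , y-z≡pᵏs , p∤s) =
    r + s , x-z≡pᵏ[r+s] , p∤↧ₙ (+-integral (integral {x = r} p∤r) (integral {x = s} p∤s))
    where
    pᵏ : ℚ
    pᵏ = ℕ→ℚ p ^ℚ k
    x-z≡pᵏ[r+s] : x - z ≡ pᵏ * (r + s)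
    x-z≡pᵏ[r+s] = begin
      x - z              ≡⟨ solve 3 (λ x y z → x :- z := (x :- y) :+ (y :- z)) refl x y z ⟩
      (x - y) + (y - z)  ≡⟨ cong₂ _+_ x-y≡pᵏr y-z≡pᵏs ⟩
      pᵏ * r + pᵏ * s    ≡⟨ *-distribˡ-+ pᵏ r s ⟨
      pᵏ * (r + s)       ∎

  ≡-mod-weaken : ∀ {x y} k j → x ≡ y [mod p ^ (k ℕ.+ j) ] → x ≡ y [mod p ^ k ]
  ≡-mod-weaken k j (r , x-y≡pᵏ⁺ʲr , p∤r) =
    P ^ℚ j * r ,
    trans x-y≡pᵏ⁺ʲr (trans (cong (_* r) (^ℚ-homo-+ P k j)) (*-assoc (P ^ℚ k) (P ^ℚ j) r)) ,
    p∤↧ₙ (*-integral (^-integral j (ℕ→ℚ-integral p)) (integral {x = r} p∤r))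
    where
    P : ℚ
    P = ℕ→ℚ p

  coherent⇒≡ : ∀ {γ x} → IsCoherent p γ → ℤ→ℚ (γ 1) ≡ x [mod p ^ 1 ] →
    ∀ n → ℤ→ℚ (γ (suc n)) ≡ x [mod p ^ 1 ]
  coherent⇒≡         coherent γ₁≡x zero    = γ₁≡x
  coherent⇒≡ {γ} {x} coherent γ₁≡x (suc n) =
    ≡-mod-trans {Γ (2 ℕ.+ n)} {Γ (1 ℕ.+ n)} {x} {1}
      (≡-mod-weaken {Γ (2 ℕ.+ n)} {Γ (1 ℕ.+ n)} 1 n (coherent (suc n)))
      (coherent⇒≡ {γ} {x} coherent γ₁≡x n)
    where
    Γ : ℕ → ℚ
    Γ n = ℤ→ℚ (γ n)

  binomialRemainder-integral : ∀ m {A X} → Integral p A → Integral p X → Integral p (binomialRemainder m A X)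
  binomialRemainder-integral zero    _      _      = ℕ→ℚ-integral 0
  binomialRemainder-integral (suc m) A∈ℤ₍ₚ₎ X∈ℤ₍ₚ₎ =
    +-integral (+-integral (*-integral A∈ℤ₍ₚ₎ T∈ℤ₍ₚ₎) (*-integral (ℕ→ℚ-integral ((2 ℕ.+ m) C 2)) (^-integral m A∈ℤ₍ₚ₎)))
               (*-integral X∈ℤ₍ₚ₎ T∈ℤ₍ₚ₎)
    where
    T∈ℤ₍ₚ₎ : Integral p (binomialRemainder m _ _)
    T∈ℤ₍ₚ₎ = binomialRemainder-integral m A∈ℤ₍ₚ₎ X∈ℤ₍ₚ₎

  residue-integral : ∀ {P A b q e z T r} → Integral p P → Integral p A → Integral p b → Integral p q →
    Integral p e → Integral p z → Integral p T → Integral p r → Integral p (AgohGiugaQuotient.residue P A b q e z T r)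
  residue-integral P∈ A∈ b∈ q∈ e∈ z∈ T∈ r∈ =
    ⊖ (q∈ ⊗ z∈ ⊗ (Abz∈ ⊕ ⊖ q∈) ⊕ A∈ ⊗ K∈ ⊕ A∈ ⊗ g₁∈ ⊗ (1∈ ⊕ (1∈ ⊕ 1∈) ⊗ Abz∈ ⊕ ⊖ q∈) ⊕ P∈ ⊗ A∈ ⊗ g₁∈ ⊗ g₁∈)
    where
    infixl 6 _⊕_
    infixl 7 _⊗_
    _⊕_ : ∀ {x y} → Integral p x → Integral p y → Integral p (x + y)
    _⊕_ = +-integral
    _⊗_ : ∀ {x y} → Integral p x → Integral p y → Integral p (x * y)
    _⊗_ = *-integral
    ⊖ : ∀ {x} → Integral p x → Integral p (- x)
    ⊖ = -‿integral
    1∈ : Integral p 1ℚ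
    1∈ = ℕ→ℚ-integral 1
    Abz∈ K∈ g₁∈ : Integral p _
    Abz∈ = A∈ ⊗ b∈ ⊗ z∈
    K∈   = r∈ ⊕ ⊖ (e∈ ⊗ b∈ ⊗ z∈ ⊗ z∈) ⊕ ⊖ (z∈ ⊗ z∈ ⊗ z∈ ⊗ T∈)
    g₁∈  = P∈ ⊗ K∈ ⊕ ⊖ (Abz∈ ⊕ b∈ ⊗ z∈ ⊗ z∈)

open AgohGiugaQuotient using (residue; quotient-identity)

proposition3 : (p : ℕ) → Prime p → 11 ≤ p →
    (a : ℕ) → 1 ≤ a → a ≤ p ∸ 1 →
    (γ : ℕ → ℤ) → IsCoherent p γ →
    (∀ n → (ℤ→ℚ (γ n) ^ℚ (p ∸ 1)) + ℕ→ℚ p * bernoulli (p ∸ 1) ≡ 0ℚ [mod p ^ n ]) →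
    ℤ→ℚ (γ 1) ≡ ℕ→ℚ a [mod p ^ 1 ] →
    let pB = ℕ→ℚ p * bernoulli (p ∸ 1)
        P  = ℕ→ℚ p
        A  = ℕ→ℚ a
        invP = (+ 1 / suc (p ∸ 1))
        AG = (1ℚ + pB) * invP
        qa = ((A ^ℚ (p ∸ 1)) - 1ℚ) * invP
        za = (ℤ→ℚ (γ 3) - A) * invP
    in za ≡ A * (qa + AG) + A * P * (1ℚ + AG) * (qa + AG) [mod p ^ 2 ]
proposition3 zero _ ()
proposition3 1    _ (s≤s ())
proposition3 2    _ (s≤s (s≤s ()))
proposition3 p@(suc (suc (suc m))) p-prime _ a 0<a a≤p-1 γ coherent root γ₁≡a =
  let z , γ₃-A≡Pz , p∤z = coherent⇒≡ {γ} {A} coherent γ₁≡a 2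
      r , root₃ , p∤r    = root 3
      q , aᴺ≡1+pq        = a^[p-1]≡1+pk p-prime 0<a (s≤s a≤p-1)
      e , C≡1+pe         = [p-1]C2≡1+pe p-prime (s≤s (s≤s (s≤s z≤n)))
      Q                  = ℕ→ℚ q
      E                  = ℕ→ℚ e
      T                  = binomialRemainder m A (P * z)
      γ₃ᴺ≡               = γᴺ≡γᴺ-expansion m P A γ₃ z E γ₃-A≡Pz N≡P-1 (ℕ→ℚ-1+m*n p e C≡1+pe)
  in residue P A b Q E z T r ,
     quotient-identity P A b Q E z T r {+ 1 / p} {γ₃} {pB} (ℕ→ℚ-*-inverseʳ (2 ℕ.+ m))
       (trans (sym (ℕ→ℚ-homo-^ a (2 ℕ.+ m))) (ℕ→ℚ-1+m*n p q aᴺ≡1+pq)) γ₃-A≡Pz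
       (subst (λ t → t + pB - 0ℚ ≡ P ^ℚ 3 * r) γ₃ᴺ≡ root₃) ,
     p∤↧ₙ (residue-integral P∈ℤ₍ₚ₎ A∈ℤ₍ₚ₎ (^-integral m A∈ℤ₍ₚ₎) (ℕ→ℚ-integral q) (ℕ→ℚ-integral e) (integral {x = z} p∤z)
             (binomialRemainder-integral m A∈ℤ₍ₚ₎ (*-integral P∈ℤ₍ₚ₎ (integral {x = z} p∤z))) (integral {x = r} p∤r))
  where
  open Integrality p-prime
  P A b γ₃ pB : ℚ
  P  = ℕ→ℚ p
  A  = ℕ→ℚ a
  b  = A ^ℚ m
  γ₃ = ℤ→ℚ (γ 3)
  pB = P * bernoulli (2 ℕ.+ m)
  P∈ℤ₍ₚ₎ : Integral p P
  P∈ℤ₍ₚ₎ = ℕ→ℚ-integral p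
  A∈ℤ₍ₚ₎ : Integral p A
  A∈ℤ₍ₚ₎ = ℕ→ℚ-integral a
  N≡P-1 : ℕ→ℚ (2 ℕ.+ m) ≡ P - 1ℚ
  N≡P-1 = ℕ→ℚ≡ℕ→ℚ[1+n]-1 (2 ℕ.+ m)
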